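{- Let $q,r$ be distinct odd primes, $\alpha,\beta,\gamma\geq 1$ integers, and $\Gamma=\mathrm{Cay}(\mathbb{Z}_{2}\times\mathbb{Z}_{2^{\alpha}q^{\beta}r^{\gamma}},\Phi)$ with $\Phi=\varphi_2\times\varphi_{2^{\alpha}q^{\beta}r^{\gamma}}$. Then $\Gamma$ has no connected dominating set, and $\gamma_t(\Gamma)=12$.
   Context: For $n\geq 1$, $\mathbb{Z}_n=\{0,\dots,n-1\}$ is the integers mod $n$ and $\varphi_n$ is the set of elements of $\mathbb{Z}_n$ coprime to $n$. $\mathrm{Cay}(\mathbb{Z}_p\times\mathbb{Z}_m,\varphi_p\times\varphi_m)$ is the graph on $\mathbb{Z}_p\times\mathbb{Z}_m$ where $(u,v)\sim(u',v')$ iff $u-u'\in\varphi_p$ and $v-v'\in\varphi_m$. A total dominating set is a vertex set $T$ such that every vertex is adjacent to some vertex of $T$; $\gamma_t$ is the minimum size of one. A connected dominating set is a dominating set inducing a connected subgraph. -}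

module Defs where

open import Data.Nat using (ℕ; _∸_; _+_; _≤ᵇ_)
open import Data.Nat.Coprimality using (Coprime)
open import Data.Fin using (Fin; toℕ)
open import Data.Bool using (if_then_else_)
open import Data.Product using (_×_; _,_; Σ-syntax)
open import Data.Sum using (_⊎_)
open import Data.List using (List)
open import Data.List.Membership.Propositional using (_∈_)

diffMod : (n : ℕ) → Fin n → Fin n → ℕ
diffMod n a b =
  if toℕ b ≤ᵇ toℕ a then toℕ a ∸ toℕ b else (n ∸ toℕ b) + toℕ a

-- x - y ∈ φ_n  (the residue of x - y is coprime to n)
InPhi : (n : ℕ) → Fin n → Fin n → Set
InPhi n x y = Coprime (diffMod n x y) n

Vertex : ℕ → ℕ → Set
Vertex p m = Fin p × Fin m

Adj : (p m : ℕ) → Vertex p m → Vertex p m → Set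
Adj p m (u , v) (u' , v') = InPhi p u u' × InPhi m v v'

Dominating : (p m : ℕ) → List (Vertex p m) → Set
Dominating p m T = ∀ x → x ∈ T ⊎ (Σ[ y ∈ Vertex p m ] (y ∈ T × Adj p m y x))

TotalDominating : (p m : ℕ) → List (Vertex p m) → Set
TotalDominating p m T = ∀ x → Σ[ y ∈ Vertex p m ] (y ∈ T × Adj p m y x)

data ReachIn (p m : ℕ) (T : List (Vertex p m)) : Vertex p m → Vertex p m → Set where
  here : ∀ {x} → ReachIn p m T x x
  step : ∀ {x z y} → Adj p m x z → z ∈ T → ReachIn p m T z y → ReachIn p m T x y

InducedConnected : (p m : ℕ) → List (Vertex p m) → Set
InducedConnected p m T = ∀ x y → x ∈ T → y ∈ T → ReachIn p m T x y

ConnectedDominating : (p m : ℕ) → List (Vertex p m) → Set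
ConnectedDominating p m T = Dominating p m T × InducedConnected p m T

-- Every edge changes both coordinates' parities (differences must be odd in both factors), so
-- (u + v) mod 2 is constant on components: the graph splits into two halves and no dominating set is
-- connected. A vertex (u, w) is totally dominated from {0,1} × {0,…,5}: among the three v ≤ 5 of parity
-- opposite to w, the differences v - w are pairwise 2 or 4 apart, so q divides at most one and r at
-- most one of them. Conversely split a total dominating set into the four classes given by u and the
-- parity of v. If some class had at most two members, with second coordinates a and b, then by the
-- Chinese remainder theorem there is w of the other parity with w ≡ a (mod q) and w ≡ b (mod r); the
-- vertex (1 - u, w) can only be dominated from that class, but a - w and b - w are not units. Hence
-- every class has at least three members.

module Submission where

open import Defs
open import Data.Nat using (ℕ; _*_; _^_; _≥_; _≤_)
open import Data.Nat.Divisibility using (_∣_)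
open import Data.Nat.Primality using (Prime)
open import Data.List using (List; length)
open import Data.List.Relation.Unary.Unique.Propositional using (Unique)
open import Data.Product using (_×_; Σ-syntax)
open import Relation.Nullary using (¬_)
open import Relation.Binary.PropositionalEquality using (_≡_; _≢_)

open import Data.Bool.Base using (T; true; false; if_then_else_)
open import Data.Empty using (⊥-elim)
open import Data.Fin.Base using (Fin; zero; suc; toℕ; inject≤; combine; opposite)
open import Data.Fin.Properties using (toℕ<n; toℕ-inject≤; toℕ-combine; toℕ-fromℕ<; toℕ-injective)
  renaming (_≟_ to _≟ᶠ_)
open import Data.List.Base using ([]; _∷_; map; filter; cartesianProduct; allFin)
open import Data.List.Membership.Propositional using (_∈_)
open import Data.List.Membership.Propositional.Properties
  using (∈-map⁺; ∈-filter⁺; ∈-cartesianProduct⁺; ∈-allFin)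
open import Data.List.Relation.Unary.Any using (here; there)
open import Data.List.Relation.Unary.Unique.Propositional.Properties
  using (map⁺; cartesianProduct⁺; allFin⁺)
open import Data.Nat.Base
  using (suc; _+_; _∸_; _≤ᵇ_; z≤n; s≤s; NonZero; NonTrivial; >-nonZero; nonTrivial⇒≢1; nonTrivial⇒n>1)
open import Data.Nat.Coprimality as Coprime
  using (Coprime; coprime-Bézout; coprime-divisor; 1-coprimeTo; ¬0-coprimeTo-2+)
open import Data.Nat.DivMod
open import Data.Nat.Divisibility
  using (divides; ∣-refl; ∣-trans; ∣m⇒∣m*n; ∣n⇒∣m*n; m∣m*n; n∣m*n; ∣m+n∣m⇒∣n; _∣?_)
open import Data.Nat.GCD using (module Bézout)
open import Data.Nat.Primality using (prime[2]; prime⇒nonZero; prime⇒nonTrivial; prime⇒irreducible)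
open import Data.Nat.Properties
open import Data.Product using (_,_; proj₁; proj₂; ∃-syntax; map₂; swap)
open import Data.Sum using (_⊎_; inj₁; inj₂)
open import Function using (_∘_)
open import Relation.Nullary using (yes; no; does; contradiction)
open import Relation.Unary using (Pred; Decidable)
open import Relation.Unary.Properties using (∁?)
open import Relation.Binary.PropositionalEquality
  using (refl; sym; trans; cong; cong₂; subst; module ≡-Reasoning)

private
  variable
    a b c d n : ℕ

[m+n]%d≡n%d⇒d∣m : .{{_ : NonZero d}} → ∀ a b → (a + b) % d ≡ b % d → d ∣ a
[m+n]%d≡n%d⇒d∣m {d} a b eq = ∣m+n∣m⇒∣n (divides ((a + b) / d) quotients) (n∣m*n (b / d))
  where
  open ≡-Reasoning
  quotients : b / d * d + a ≡ (a + b) / d * d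
  quotients = +-cancelˡ-≡ (b % d) _ _ (begin
    b % d + (b / d * d + a)   ≡⟨ sym (+-assoc (b % d) _ a) ⟩
    b % d + b / d * d + a     ≡⟨ cong (_+ a) (sym (m≡m%n+[m/n]*n b d)) ⟩
    b + a                     ≡⟨ +-comm b a ⟩
    a + b                     ≡⟨ m≡m%n+[m/n]*n (a + b) d ⟩
    (a + b) % d + (a + b) / d * d ≡⟨ cong (_+ (a + b) / d * d) eq ⟩
    b % d + (a + b) / d * d   ∎)

%-reduce : .{{_ : NonZero d}} .{{_ : NonZero n}} → d ∣ n → a % n ≡ b % n → a % d ≡ b % d
%-reduce {d} {n} {a} {b} d∣n eq = begin
  a % d     ≡⟨ sym (m∣n⇒o%n%m≡o%m d n a d∣n) ⟩
  a % n % d ≡⟨ cong (_% d) eq ⟩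
  b % n % d ≡⟨ m∣n⇒o%n%m≡o%m d n b d∣n ⟩
  b % d     ∎
  where open ≡-Reasoning

toℕ-mod : .{{_ : NonZero d}} .{{_ : NonZero n}} → d ∣ n → ∀ a → toℕ (a mod n) % d ≡ a % d
toℕ-mod {n = n} d∣n a = %-reduce d∣n (trans (cong (_% n) (toℕ-fromℕ< _)) (m%n%n≡m%n a n))

*-%-unit : .{{_ : NonZero d}} → b % d ≡ 1 % d → (a * b) % d ≡ a % d
*-%-unit {d} {b} {a} b≡1 = begin
  a * b % d               ≡⟨ %-distribˡ-* a b d ⟩
  (a % d * (b % d)) % d   ≡⟨ cong (λ x → (a % d * x) % d) b≡1 ⟩
  (a % d * (1 % d)) % d   ≡⟨ sym (%-distribˡ-* a 1 d) ⟩
  a * 1 % d               ≡⟨ cong (_% d) (*-identityʳ a) ⟩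
  a % d                   ∎
  where open ≡-Reasoning

n%2≢[1+n]%2 : ∀ n → n % 2 ≢ suc n % 2
n%2≢[1+n]%2 0 ()
n%2≢[1+n]%2 1 ()
n%2≢[1+n]%2 (suc (suc n)) = n%2≢[1+n]%2 n

%2≢⇒≡[1+] : ∀ a b → a % 2 ≢ b % 2 → a % 2 ≡ suc b % 2
%2≢⇒≡[1+] 0 0 ne = contradiction refl ne
%2≢⇒≡[1+] 0 1 _ = refl
%2≢⇒≡[1+] 1 0 _ = refl
%2≢⇒≡[1+] 1 1 ne = contradiction refl ne
%2≢⇒≡[1+] (suc (suc a)) b ne = %2≢⇒≡[1+] a b ne
%2≢⇒≡[1+] a (suc (suc b)) ne = %2≢⇒≡[1+] a b ne

+-%2-flip : ∀ a b c d → a % 2 ≡ suc c % 2 → b % 2 ≡ suc d % 2 → (a + b) % 2 ≡ (c + d) % 2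
+-%2-flip a b c d a≡ b≡ = begin
  (a + b) % 2               ≡⟨ %-distribˡ-+ a b 2 ⟩
  (a % 2 + b % 2) % 2       ≡⟨ cong₂ (λ x y → (x + y) % 2) a≡ b≡ ⟩
  (suc c % 2 + suc d % 2) % 2 ≡⟨ sym (%-distribˡ-+ (suc c) (suc d) 2) ⟩
  (suc c + suc d) % 2       ≡⟨ cong (λ x → suc x % 2) (+-suc c d) ⟩
  (c + d) % 2               ∎
  where open ≡-Reasoning

crt-idempotent : .{{_ : NonZero a}} → Coprime a b → ∃[ e ] e % a ≡ 1 % a × b ∣ e
crt-idempotent {a} {b} a⊥b with coprime-Bézout a⊥b
... | Bézout.-+ x y eq = y * b , trans (cong (_% a) (sym eq)) ([m+kn]%n≡m%n 1 x a) , n∣m*n y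
... | Bézout.+- x y eq = z * z , z²≡1 , ∣m⇒∣m*n z (n∣m*n y)
  where
  -- 1 + z = x a, so z ≡ -1 and z² ≡ 1 (mod a).
  z = y * b
  open ≡-Reasoning
  z²+xa : z * z + x * a ≡ 1 + z * x * a
  z²+xa = begin
    z * z + x * a       ≡⟨ cong (z * z +_) (sym eq) ⟩
    z * z + suc z       ≡⟨ +-suc (z * z) z ⟩
    suc (z * z + z)     ≡⟨ cong suc (+-comm (z * z) z) ⟩
    suc (z + z * z)     ≡⟨ cong suc (sym (*-suc z z)) ⟩
    1 + z * suc z       ≡⟨ cong (λ t → 1 + z * t) eq ⟩
    1 + z * (x * a)     ≡⟨ cong (1 +_) (sym (*-assoc z x a)) ⟩
    1 + z * x * a       ∎
  z²≡1 : z * z % a ≡ 1 % a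
  z²≡1 = begin
    z * z % a           ≡⟨ sym ([m+kn]%n≡m%n (z * z) x a) ⟩
    (z * z + x * a) % a ≡⟨ cong (_% a) z²+xa ⟩
    (1 + z * x * a) % a ≡⟨ [m+kn]%n≡m%n 1 (z * x) a ⟩
    1 % a               ∎

chinese-remainder : .{{_ : NonZero a}} .{{_ : NonZero b}} → Coprime a b →
      ∀ x y → ∃[ w ] w % a ≡ x % a × w % b ≡ y % b
chinese-remainder a⊥b x y with crt-idempotent a⊥b | crt-idempotent (Coprime.sym a⊥b)
... | e , e≡1 , b∣e | f , f≡1 , a∣f =
  x * e + y * f ,
  trans (%-remove-+ʳ (x * e) (∣n⇒∣m*n y a∣f)) (*-%-unit e≡1) ,
  trans (%-remove-+ˡ (y * f) (∣n⇒∣m*n x b∣e)) (*-%-unit f≡1)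

¬∣⇒coprime : ∀ {p} → Prime p → ¬ p ∣ n → Coprime n p
¬∣⇒coprime p-prime p∤n (i∣n , i∣p) with prime⇒irreducible p-prime i∣p
... | inj₁ i≡1 = i≡1
... | inj₂ refl = contradiction i∣n p∤n

primes-coprime : ∀ {p p′} → Prime p → Prime p′ → p ≢ p′ → Coprime p p′
primes-coprime {p} {p′} p-prime p′-prime p≢p′ = ¬∣⇒coprime p′-prime p′∤p
  where
  p′∤p : ¬ p′ ∣ p
  p′∤p p′∣p with prime⇒irreducible p-prime p′∣p
  ... | inj₁ refl = contradiction p′-prime λ ()
  ... | inj₂ p′≡p = p≢p′ (sym p′≡p)

coprime-*ʳ : Coprime a b → Coprime a c → Coprime a (b * c)
coprime-*ʳ a⊥b a⊥c (i∣a , i∣bc) =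
  a⊥c (i∣a , coprime-divisor (λ (j∣i , j∣b) → a⊥b (∣-trans j∣i i∣a , j∣b)) i∣bc)

coprime-^ʳ : Coprime a b → ∀ k → Coprime a (b ^ k)
coprime-^ʳ {a} a⊥b 0 = Coprime.sym (1-coprimeTo a)
coprime-^ʳ a⊥b (suc k) = coprime-*ʳ a⊥b (coprime-^ʳ a⊥b k)

¬∣⇒coprime-^ : ∀ {p} → Prime p → ¬ p ∣ n → ∀ k → Coprime n (p ^ k)
¬∣⇒coprime-^ p-prime p∤n = coprime-^ʳ (¬∣⇒coprime p-prime p∤n)

m∣m^n : ∀ {k} → 1 ≤ k → a ∣ a ^ k
m∣m^n {a} {suc k} _ = m∣m*n (a ^ k)

2≤p^k : ∀ {p k} → Prime p → 1 ≤ k → 2 ≤ p ^ k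
2≤p^k {p} {suc k} p-prime _ =
  *-mono-≤ (nonTrivial⇒n>1 p {{prime⇒nonTrivial p-prime}}) (m^n>0 p {{prime⇒nonZero p-prime}} k)

odd-prime-coprimeTo-2 : ∀ {p} → Prime p → ¬ 2 ∣ p → Coprime 2 p
odd-prime-coprimeTo-2 p-prime 2∤p = primes-coprime prime[2] p-prime λ { refl → 2∤p ∣-refl }

-- diffMod n x y unfolded, so that `with` can split on the comparison.
diffMod-+-cases : ∀ x y → y ≤ n →
  (if y ≤ᵇ x then x ∸ y else (n ∸ y) + x) + y ≡ x ⊎
  (if y ≤ᵇ x then x ∸ y else (n ∸ y) + x) + y ≡ n + x
diffMod-+-cases {n} x y y≤n with y ≤ᵇ x in y≤ᵇx
... | true = inj₁ (m∸n+n≡m (≤ᵇ⇒≤ y x (subst T (sym y≤ᵇx) _)))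
... | false = inj₂ (begin
  (n ∸ y) + x + y ≡⟨ +-assoc (n ∸ y) x y ⟩
  (n ∸ y) + (x + y) ≡⟨ cong ((n ∸ y) +_) (+-comm x y) ⟩
  (n ∸ y) + (y + x) ≡⟨ sym (+-assoc (n ∸ y) y x) ⟩
  (n ∸ y) + y + x ≡⟨ cong (_+ x) (m∸n+n≡m y≤n) ⟩
  n + x           ∎)
  where open ≡-Reasoning

diffMod-+-% : .{{_ : NonZero d}} → d ∣ n → ∀ (x y : Fin n) → (diffMod n x y + toℕ y) % d ≡ toℕ x % d
diffMod-+-% {d} {n} d∣n x y with diffMod-+-cases (toℕ x) (toℕ y) (<⇒≤ (toℕ<n y))
... | inj₁ eq = cong (_% d) eq
... | inj₂ eq = trans (cong (_% d) eq) (%-remove-+ˡ (toℕ x) d∣n)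

∣diffMod⇒≡ : .{{_ : NonZero d}} → d ∣ n → ∀ (x y : Fin n) → d ∣ diffMod n x y → toℕ x % d ≡ toℕ y % d
∣diffMod⇒≡ d∣n x y d∣D = trans (sym (diffMod-+-% d∣n x y)) (%-remove-+ˡ (toℕ y) d∣D)

≡⇒∣diffMod : .{{_ : NonZero d}} → d ∣ n → ∀ (x y : Fin n) → toℕ x % d ≡ toℕ y % d → d ∣ diffMod n x y
≡⇒∣diffMod d∣n x y eq = [m+n]%d≡n%d⇒d∣m _ (toℕ y) (trans (diffMod-+-% d∣n x y) eq)

InPhi⇒≢ : .{{_ : NonZero d}} .{{_ : NonTrivial d}} → d ∣ n → ∀ (x y : Fin n) →
          InPhi n x y → toℕ x % d ≢ toℕ y % d
InPhi⇒≢ d∣n x y x⊥y eq = nonTrivial⇒≢1 (x⊥y (≡⇒∣diffMod d∣n x y eq , d∣n))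

InPhi-opposite : ∀ u → InPhi 2 (opposite u) u
InPhi-opposite zero = 1-coprimeTo 2
InPhi-opposite (suc zero) = 1-coprimeTo 2

InPhi-opposite⇒≡ : ∀ {u u′} → InPhi 2 u (opposite u′) → u ≡ u′
InPhi-opposite⇒≡ {zero} {zero} _ = refl
InPhi-opposite⇒≡ {zero} {suc zero} 0⊥2 = ⊥-elim (¬0-coprimeTo-2+ 0⊥2)
InPhi-opposite⇒≡ {suc zero} {zero} 0⊥2 = ⊥-elim (¬0-coprimeTo-2+ 0⊥2)
InPhi-opposite⇒≡ {suc zero} {suc zero} _ = refl

module _ {m : ℕ} .{{_ : NonZero m}} (2∣m : 2 ∣ m) where

  colour : Vertex 2 m → ℕ
  colour (u , v) = (toℕ u + toℕ v) % 2

  colour-Adj : ∀ x y → Adj 2 m x y → colour x ≡ colour y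
  colour-Adj (u , v) (u′ , v′) (u⊥u′ , v⊥v′) =
    sym (+-%2-flip (toℕ u′) (toℕ v′) (toℕ u) (toℕ v) (flipped ∣-refl u u′ u⊥u′) (flipped 2∣m v v′ v⊥v′))
    where
    flipped : ∀ {n} → 2 ∣ n → (x y : Fin n) → InPhi n x y → toℕ y % 2 ≡ suc (toℕ x) % 2
    flipped 2∣n x y x⊥y = %2≢⇒≡[1+] (toℕ y) (toℕ x) (InPhi⇒≢ 2∣n x y x⊥y ∘ sym)

  colour-ReachIn : ∀ {T x y} → ReachIn 2 m T x y → colour x ≡ colour y
  colour-ReachIn here = refl
  colour-ReachIn {x = x} (step {z = z} x~z _ z↝y) = trans (colour-Adj x z x~z) (colour-ReachIn z↝y)

  dominating⇒meets-colour : ∀ {T} → Dominating 2 m T → ∀ x → ∃[ z ] z ∈ T × colour z ≡ colour x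
  dominating⇒meets-colour dom x with dom x
  ... | inj₁ x∈T = x , x∈T , refl
  ... | inj₂ (y , y∈T , y~x) = y , y∈T , colour-Adj y x y~x

  ¬connectedDominating : ∀ T → ¬ ConnectedDominating 2 m T
  ¬connectedDominating T (dom , conn) =
    let z  , z∈T  , z≡  = dominating⇒meets-colour dom (zero , v)
        z′ , z′∈T , z′≡ = dominating⇒meets-colour dom (suc zero , v)
    in n%2≢[1+n]%2 (toℕ v) (trans (sym z≡) (trans (colour-ReachIn (conn z z′ z∈T z′∈T)) z′≡))
    where
    v : Fin m
    v = 0 mod m

AtMostOnce : ∀ {n} → (Fin n → Set) → Set
AtMostOnce P = ∀ {i j} → P i → P j → i ≡ j

∃-avoiding-both-from : ∀ {P Q : Fin 3 → Set} → P zero → AtMostOnce P → Decidable Q → AtMostOnce Q →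
                       ∃[ i ] ¬ P i × ¬ Q i
∃-avoiding-both-from P₀ P-once Q? Q-once with Q? (suc zero)
... | yes Q₁ = suc (suc zero) , (λ P₂ → contradiction (P-once P₀ P₂) λ ()) ,
                                (λ Q₂ → contradiction (Q-once Q₁ Q₂) λ ())
... | no ¬Q₁ = suc zero , (λ P₁ → contradiction (P-once P₀ P₁) λ ()) , ¬Q₁

∃-avoiding-both : ∀ {P Q : Fin 3 → Set} → Decidable P → Decidable Q →
                  AtMostOnce P → AtMostOnce Q → ∃[ i ] ¬ P i × ¬ Q i
∃-avoiding-both P? Q? P-once Q-once with P? zero | Q? zero
... | no ¬P₀ | no ¬Q₀ = zero , ¬P₀ , ¬Q₀
... | yes P₀ | _      = ∃-avoiding-both-from P₀ P-once Q? Q-once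
... | no _   | yes Q₀ = map₂ swap (∃-avoiding-both-from Q₀ Q-once P? P-once)

[2i+c]%d-injective : .{{_ : NonZero d}} .{{_ : NonTrivial d}} → Coprime 2 d →
                     ∀ c (i j : Fin 3) → (2 * toℕ i + c) % d ≡ (2 * toℕ j + c) % d → i ≡ j
[2i+c]%d-injective {d} 2⊥d c = injective
  where
  d∤2 : ¬ d ∣ 2
  d∤2 d∣2 = nonTrivial⇒≢1 (2⊥d (d∣2 , ∣-refl))
  d∤4 : ¬ d ∣ 4
  d∤4 = d∤2 ∘ coprime-divisor (Coprime.sym 2⊥d)
  injective : ∀ i j → (2 * toℕ i + c) % d ≡ (2 * toℕ j + c) % d → i ≡ j
  injective zero             zero             _  = refl
  injective zero             (suc zero)       eq = contradiction ([m+n]%d≡n%d⇒d∣m 2 c (sym eq)) d∤2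
  injective zero             (suc (suc zero)) eq = contradiction ([m+n]%d≡n%d⇒d∣m 4 c (sym eq)) d∤4
  injective (suc zero)       zero             eq = contradiction ([m+n]%d≡n%d⇒d∣m 2 c eq) d∤2
  injective (suc zero)       (suc zero)       _  = refl
  injective (suc zero)       (suc (suc zero)) eq = contradiction ([m+n]%d≡n%d⇒d∣m 2 (2 + c) (sym eq)) d∤2
  injective (suc (suc zero)) zero             eq = contradiction ([m+n]%d≡n%d⇒d∣m 4 c eq) d∤4
  injective (suc (suc zero)) (suc zero)       eq = contradiction ([m+n]%d≡n%d⇒d∣m 2 (2 + c) eq) d∤2
  injective (suc (suc zero)) (suc (suc zero)) _  = refl

avoiding-any-two⇒3≤length : ∀ {A : Set} {xs : List A} → A →
                            (∀ a b → ∃[ x ] x ∈ xs × x ≢ a × x ≢ b) → 3 ≤ length xs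
avoiding-any-two⇒3≤length {xs = []} a avoids with avoids a a
... | _ , () , _
avoiding-any-two⇒3≤length {xs = x ∷ []} _ avoids with avoids x x
... | _ , here refl , x≢x , _ = contradiction refl x≢x
avoiding-any-two⇒3≤length {xs = x ∷ y ∷ []} _ avoids with avoids x y
... | _ , here refl , x≢x , _ = contradiction refl x≢x
... | _ , there (here refl) , _ , y≢y = contradiction refl y≢y
avoiding-any-two⇒3≤length {xs = _ ∷ _ ∷ _ ∷ _} _ _ = s≤s (s≤s (s≤s z≤n))

length-filter+∁ : ∀ {A : Set} {ℓ} {P : Pred A ℓ} (P? : Decidable P) xs →
                  length (filter P? xs) + length (filter (∁? P?) xs) ≡ length xs
length-filter+∁ P? [] = refl
length-filter+∁ P? (x ∷ xs) with does (P? x)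
... | true  = cong suc (length-filter+∁ P? xs)
... | false = trans (+-suc _ _) (cong suc (length-filter+∁ P? xs))

module Modulus2qr {m q r : ℕ} .{{_ : NonZero m}}
  (q-prime : Prime q) (r-prime : Prime r) (q-odd : ¬ 2 ∣ q) (r-odd : ¬ 2 ∣ r) (q≢r : q ≢ r)
  (2∣m : 2 ∣ m) (q∣m : q ∣ m) (r∣m : r ∣ m) (6≤m : 6 ≤ m)
  (coprime-to-m : ∀ {D} → ¬ 2 ∣ D → ¬ q ∣ D → ¬ r ∣ D → Coprime D m)
  where

  private instance
    q≢0 : NonZero q
    q≢0 = prime⇒nonZero q-prime
    r≢0 : NonZero r
    r≢0 = prime⇒nonZero r-prime
    qr≢0 : NonZero (q * r)
    qr≢0 = m*n≢0 q r
    q>1 : NonTrivial q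
    q>1 = prime⇒nonTrivial q-prime
    r>1 : NonTrivial r
    r>1 = prime⇒nonTrivial r-prime

  2⊥q : Coprime 2 q
  2⊥q = odd-prime-coprimeTo-2 q-prime q-odd

  2⊥r : Coprime 2 r
  2⊥r = odd-prime-coprimeTo-2 r-prime r-odd

  embed : Fin 6 → Fin m
  embed k = inject≤ k 6≤m

  embed-injective : ∀ {k k′} → embed k ≡ embed k′ → k ≡ k′
  embed-injective {k} {k′} eq =
    toℕ-injective (trans (sym (toℕ-inject≤ k 6≤m)) (trans (cong toℕ eq) (toℕ-inject≤ k′ 6≤m)))

  T12 : List (Vertex 2 m)
  T12 = map (map₂ embed) (cartesianProduct (allFin 2) (allFin 6))

  T12-unique : Unique T12
  T12-unique = map⁺ (λ eq → cong₂ _,_ (cong proj₁ eq) (embed-injective (cong proj₂ eq)))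
                    (cartesianProduct⁺ (allFin⁺ 2) (allFin⁺ 6))

  ∈-T12 : ∀ u k → (u , embed k) ∈ T12
  ∈-T12 u k = ∈-map⁺ (map₂ embed) (∈-cartesianProduct⁺ (∈-allFin u) (∈-allFin k))

  -- 2i + c for i < 3 and c the parity opposite to w's: the elements of {0,…,5} of that parity.
  candidate : Fin m → Fin 3 → Fin m
  candidate w i = embed (combine i (suc (toℕ w) mod 2))

  toℕ-candidate : ∀ w i → toℕ (candidate w i) ≡ 2 * toℕ i + toℕ (suc (toℕ w) mod 2)
  toℕ-candidate w i = trans (toℕ-inject≤ _ 6≤m) (toℕ-combine i _)

  candidate-%2 : ∀ w i → toℕ (candidate w i) % 2 ≡ suc (toℕ w) % 2
  candidate-%2 w i = begin
    toℕ (candidate w i) % 2 ≡⟨ cong (_% 2) (toℕ-candidate w i) ⟩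
    (2 * toℕ i + c₀) % 2     ≡⟨ %-remove-+ˡ c₀ (m∣m*n (toℕ i)) ⟩
    c₀ % 2                   ≡⟨ toℕ-mod {n = 2} ∣-refl (suc (toℕ w)) ⟩
    suc (toℕ w) % 2         ∎
    where
    open ≡-Reasoning
    c₀ = toℕ (suc (toℕ w) mod 2)

  candidate-once : .{{_ : NonZero d}} .{{_ : NonTrivial d}} → Coprime 2 d → d ∣ m →
                   ∀ w → AtMostOnce (λ i → d ∣ diffMod m (candidate w i) w)
  candidate-once {d} 2⊥d d∣m w {i} {j} d∣Dᵢ d∣Dⱼ = [2i+c]%d-injective 2⊥d c₀ i j (begin
    (2 * toℕ i + c₀) % d     ≡⟨ cong (_% d) (sym (toℕ-candidate w i)) ⟩
    toℕ (candidate w i) % d ≡⟨ ∣diffMod⇒≡ d∣m _ w d∣Dᵢ ⟩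
    toℕ w % d               ≡⟨ sym (∣diffMod⇒≡ d∣m _ w d∣Dⱼ) ⟩
    toℕ (candidate w j) % d ≡⟨ cong (_% d) (toℕ-candidate w j) ⟩
    (2 * toℕ j + c₀) % d     ∎)
    where
    open ≡-Reasoning
    c₀ = toℕ (suc (toℕ w) mod 2)

  T12-totalDominating : TotalDominating 2 m T12
  T12-totalDominating (u , w)
    with ∃-avoiding-both (λ i → q ∣? D i) (λ i → r ∣? D i) (candidate-once 2⊥q q∣m w) (candidate-once 2⊥r r∣m w)
    where
    D : Fin 3 → ℕ
    D i = diffMod m (candidate w i) w
  ... | i , q∤Dᵢ , r∤Dᵢ =
    (opposite u , candidate w i) , ∈-T12 (opposite u) _ , InPhi-opposite u , coprime-to-m 2∤Dᵢ q∤Dᵢ r∤Dᵢ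
    where
    2∤Dᵢ : ¬ 2 ∣ diffMod m (candidate w i) w
    2∤Dᵢ 2∣Dᵢ = n%2≢[1+n]%2 (toℕ w) (trans (sym (∣diffMod⇒≡ 2∣m _ w 2∣Dᵢ)) (candidate-%2 w i))

  residues : ∀ e a b → ∃[ w ] toℕ w % 2 ≡ e % 2 × toℕ w % q ≡ a % q × toℕ w % r ≡ b % r
  residues e a b =
    let W₀ , W₀≡a , W₀≡b = chinese-remainder (primes-coprime q-prime r-prime q≢r) a b
        W  , W≡e  , W≡W₀ = chinese-remainder (coprime-*ʳ 2⊥q 2⊥r) e W₀
    in W mod m ,
       trans (toℕ-mod 2∣m W) W≡e ,
       trans (toℕ-mod q∣m W) (trans (%-reduce {q} {q * r} (m∣m*n r) W≡W₀) W₀≡a) ,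
       trans (toℕ-mod r∣m W) (trans (%-reduce {r} {q * r} (n∣m*n q) W≡W₀) W₀≡b)

  parity : Vertex 2 m → ℕ
  parity (_ , v) = toℕ v % 2

  -- The witness dominates (1 - u, w) where w ≡ 1 + e (mod 2), w ≡ a (mod q) and w ≡ b (mod r).
  totalDominating-avoids : ∀ {L} → TotalDominating 2 m L → ∀ u e (a b : Fin m) →
    ∃[ y ] y ∈ L × proj₁ y ≡ u × parity y ≡ e % 2 × proj₂ y ≢ a × proj₂ y ≢ b
  totalDominating-avoids td u e a b =
    let w , w≡1+e , w≡a , w≡b = residues (suc e) (toℕ a) (toℕ b)
        (u′ , v′) , y∈L , u′⊥ , v′⊥ = td (opposite u , w)
    in (u′ , v′) , y∈L , InPhi-opposite⇒≡ u′⊥ ,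
       %2≢⇒≡[1+] (toℕ v′) (suc e) (λ eq → InPhi⇒≢ 2∣m v′ w v′⊥ (trans eq (sym w≡1+e))) ,
       (λ v′≡a → InPhi⇒≢ q∣m v′ w v′⊥ (trans (cong (λ x → toℕ x % q) v′≡a) (sym w≡a))) ,
       (λ v′≡b → InPhi⇒≢ r∣m v′ w v′⊥ (trans (cong (λ x → toℕ x % r) v′≡b) (sym w≡b)))

  3≤class : ∀ {L} → TotalDominating 2 m L →
            ∀ {P : Fin 2 → Set} {Q : ℕ → Set} (P? : Decidable P) (Q? : Decidable Q) u e →
            P u → Q (e % 2) → 3 ≤ length (filter (Q? ∘ parity) (filter (P? ∘ proj₁) L))
  3≤class {L} td {P} {Q} P? Q? u e Pu Qe = avoiding-any-two⇒3≤length (u , 0 mod m) avoids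
    where
    avoids : ∀ a b → ∃[ y ] y ∈ filter (Q? ∘ parity) (filter (P? ∘ proj₁) L) × y ≢ a × y ≢ b
    avoids a b =
      let y , y∈L , y≡u , y≡e , y≢a , y≢b = totalDominating-avoids td u e (proj₂ a) (proj₂ b)
      in y , ∈-filter⁺ (Q? ∘ parity) (∈-filter⁺ (P? ∘ proj₁) y∈L (subst P (sym y≡u) Pu))
                                      (subst Q (sym y≡e) Qe) ,
         y≢a ∘ cong proj₂ , y≢b ∘ cong proj₂

  12≤length : ∀ {L} → TotalDominating 2 m L → 12 ≤ length L
  12≤length {L} td = begin
    3 + 3 + (3 + 3)
      ≤⟨ +-mono-≤ (+-mono-≤ (class first? even? zero 0 refl refl)
                            (class first? (∁? even?) zero 1 refl λ ()))
                  (+-mono-≤ (class (∁? first?) even? (suc zero) 0 (λ ()) refl)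
                            (class (∁? first?) (∁? even?) (suc zero) 1 (λ ()) λ ())) ⟩
    length (filter (even? ∘ parity) F) + length (filter (∁? even? ∘ parity) F) +
      (length (filter (even? ∘ parity) F′) + length (filter (∁? even? ∘ parity) F′))
      ≡⟨ cong₂ _+_ (length-filter+∁ (even? ∘ parity) F) (length-filter+∁ (even? ∘ parity) F′) ⟩
    length F + length F′
      ≡⟨ length-filter+∁ (first? ∘ proj₁) L ⟩
    length L ∎
    where
    open ≤-Reasoning
    first? : Decidable (_≡ zero)
    first? u = u ≟ᶠ zero
    even? : Decidable (_≡ 0)
    even? k = k ≟ 0
    F  = filter (first? ∘ proj₁) L
    F′ = filter (∁? first? ∘ proj₁) L
    class = 3≤class td

lemma4p2 : (q r α β γ : ℕ) → Prime q → Prime r → ¬ (2 ∣ q) → ¬ (2 ∣ r) → q ≢ r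
    → α ≥ 1 → β ≥ 1 → γ ≥ 1
    → (∀ (T : List (Vertex 2 (2 ^ α * q ^ β * r ^ γ)))
         → ¬ ConnectedDominating 2 (2 ^ α * q ^ β * r ^ γ) T)
      × (Σ[ T ∈ List (Vertex 2 (2 ^ α * q ^ β * r ^ γ)) ]
           (Unique T × length T ≡ 12 × TotalDominating 2 (2 ^ α * q ^ β * r ^ γ) T))
      × (∀ (T : List (Vertex 2 (2 ^ α * q ^ β * r ^ γ)))
           → TotalDominating 2 (2 ^ α * q ^ β * r ^ γ) T → 12 ≤ length T)
lemma4p2 q r α β γ q-prime r-prime q-odd r-odd q≢r α≥1 β≥1 γ≥1 =
  ¬connectedDominating 2∣M ,
  (T12 , T12-unique , refl , T12-totalDominating) ,
  λ _ → 12≤length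
  where
  M = 2 ^ α * q ^ β * r ^ γ
  6≤M : 6 ≤ M
  6≤M = ≤-trans (m≤m+n 6 2)
    (*-mono-≤ (*-mono-≤ (2≤p^k prime[2] α≥1) (2≤p^k q-prime β≥1)) (2≤p^k r-prime γ≥1))
  instance
    M≢0 : NonZero M
    M≢0 = >-nonZero (≤-trans (s≤s z≤n) 6≤M)
  2∣M : 2 ∣ M
  2∣M = ∣m⇒∣m*n (r ^ γ) (∣m⇒∣m*n (q ^ β) (m∣m^n α≥1))
  q∣M : q ∣ M
  q∣M = ∣m⇒∣m*n (r ^ γ) (∣n⇒∣m*n (2 ^ α) (m∣m^n β≥1))
  r∣M : r ∣ M
  r∣M = ∣n⇒∣m*n (2 ^ α * q ^ β) (m∣m^n γ≥1)
  coprime-to-M : ∀ {D} → ¬ 2 ∣ D → ¬ q ∣ D → ¬ r ∣ D → Coprime D M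
  coprime-to-M 2∤D q∤D r∤D = coprime-*ʳ
    (coprime-*ʳ (¬∣⇒coprime-^ prime[2] 2∤D α) (¬∣⇒coprime-^ q-prime q∤D β))
    (¬∣⇒coprime-^ r-prime r∤D γ)
  open Modulus2qr q-prime r-prime q-odd r-odd q≢r 2∣M q∣M r∣M 6≤M coprime-to-M
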